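{- (Substitution.) If $M:\langle\Gamma,x:U\vdash V\rangle$ and $N:\langle\Delta\vdash U\rangle$, then $M[x:=N]:\langle\Gamma\sqcap\Delta\vdash V\rangle$.
   Context: Terms: $\mathcal V$ is a denumerably infinite set of variables; $\mathcal M$ is the set of untyped $\lambda$-terms $M::=x\mid \lambda x.M\mid MM$ taken modulo $\alpha$-conversion (bound variables chosen distinct from free ones); $FV(M)$ is the set of free variables; $M[x:=N]$ is capture-avoiding substitution. Types: $\mathcal A$ is a denumerably infinite set of atomic types; $\mathbb T::=a\mid \mathbb U\to\mathbb T$ ($a\in\mathcal A$) and $\mathbb U::=\omega\mid \mathbb U\sqcap\mathbb U\mid \mathbb T$; types are quotiented by commutativity, associativity and idempotence of $\sqcap$ and by $\omega\sqcap U=U$. $T$ ranges over $\mathbb T$, $U,V$ over $\mathbb U$. Environments: a type environment is a finite set $(x_i:U_i)_n$ of declarations with pairwise distinct variables; $dom$ is its set of variables; $\Gamma,x:U$ requires $x\notin dom(\Gamma)$; $env^M_\omega$ assigns $\omega$ to each variable of $FV(M)$ and nothing else; if $\Gamma_1=(x_i:U_i)_n,(y_j:V_j)_m$ and $\Gamma_2=(x_i:U'_i)_n,(z_k:W_k)_l$ with the $y_j$, $z_k$ all distinct, then $\Gamma_1\sqcap\Gamma_2=(x_i:U_i\sqcap U'_i)_n,(y_j:V_j)_m,(z_k:W_k)_l$. Subtyping: $\sqsubseteq$ (on types, on environments, and on typings $\langle\Gamma\vdash U\rangle$) is the least relation closed under: $\Phi\sqsubseteq\Phi$; transitivity; $U_1\sqcap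 U_2\sqsubseteq U_1$; if $U_1\sqsubseteq V_1$ and $U_2\sqsubseteq V_2$ then $U_1\sqcap U_2\sqsubseteq V_1\sqcap V_2$; if $U_2\sqsubseteq U_1$ and $T_1\sqsubseteq T_2$ then $U_1\to T_1\sqsubseteq U_2\to T_2$; if $U_1\sqsubseteq U_2$ and $x\notin dom(\Gamma)$ then $\Gamma,x:U_1\sqsubseteq\Gamma,x:U_2$; if $U_1\sqsubseteq U_2$ and $\Gamma_2\sqsubseteq\Gamma_1$ then $\langle\Gamma_1\vdash U_1\rangle\sqsubseteq\langle\Gamma_2\vdash U_2\rangle$. Typing rules for $M:\langle\Gamma\vdash U\rangle$: (ax) $x:\langle x:T\vdash T\rangle$ for $T\in\mathbb T$; ($\omega$) $M:\langle env^M_\omega\vdash\omega\rangle$; ($\to_i$) from $M:\langle\Gamma,x:U\vdash T\rangle$ infer $\lambda x.M:\langle\Gamma\vdash U\to T\rangle$; ($\to'_i$) from $M:\langle\Gamma\vdash T\rangle$ and $x\notin dom(\Gamma)$ infer $\lambda x.M:\langle\Gamma\vdash\omega\to T\rangle$; ($\to_e$) from $M_1:\langle\Gamma_1\vdash U\to T\rangle$ and $M_2:\langle\Gamma_2\vdash U\rangle$ infer $M_1M_2:\langle\Gamma_1\sqcap\Gamma_2\vdash T\rangle$; ($\sqcap_i$) from $M:\langle\Gamma\vdash U_1\rangle$ and $M:\langle\Gamma\vdash U_2\rangle$ infer $M:\langle\Gamma\vdash U_1\sqcap U_2\rangle$; ($\sqsubseteq$) from $M:\langle\Gamma\vdash U\rangle$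 and $\langle\Gamma\vdash U\rangle\sqsubseteq\langle\Gamma'\vdash U'\rangle$ infer $M:\langle\Gamma'\vdash U'\rangle$. -}

module Defs where

open import Data.Nat using (ℕ; zero; suc; _≡ᵇ_; _≤_)
open import Data.Bool using (Bool; true; false; if_then_else_; _∨_)
open import Data.Maybe using (Maybe; just; nothing)
open import Data.Maybe.Relation.Binary.Pointwise using (Pointwise)
open import Data.Product using (∃; _×_)
open import Relation.Binary.PropositionalEquality using (_≡_)

-- λ-terms modulo α-conversion, represented by de Bruijn indices.
-- A variable index i under d binders with i ≥ d denotes the free
-- variable (name) i ∸ d; names are natural numbers (𝒱 ≅ ℕ).

data Tm : Set where
  var : ℕ → Tm
  lam : Tm → Tm
  app : Tm → Tm → Tm

ext : (ℕ → ℕ) → ℕ → ℕ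
ext ρ zero    = zero
ext ρ (suc i) = suc (ρ i)

ren : (ℕ → ℕ) → Tm → Tm
ren ρ (var i)   = var (ρ i)
ren ρ (lam M)   = lam (ren (ext ρ) M)
ren ρ (app M N) = app (ren ρ M) (ren ρ N)

exts : (ℕ → Tm) → ℕ → Tm
exts σ zero    = var zero
exts σ (suc i) = ren suc (σ i)

sub : (ℕ → Tm) → Tm → Tm
sub σ (var i)   = σ i
sub σ (lam M)   = lam (sub (exts σ) M)
sub σ (app M N) = app (sub σ M) (sub σ N)

_[_:=_] : Tm → ℕ → Tm → Tm
M [ x := N ] = sub (λ i → if i ≡ᵇ x then N else var i) M

fv : Tm → ℕ → Bool
fv (var j)   i = j ≡ᵇ i
fv (lam M)   i = fv M (suc i)
fv (app M N) i = fv M i ∨ fv N i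

-- Types (raw syntax; the quotient by ACI of ⊓ and ω-unit is built into ⊑)

infixr 7 _⇒_
infixl 6 _⊓_

mutual
  data Ty : Set where
    atom : ℕ → Ty
    _⇒_  : IT → Ty → Ty

  data IT : Set where
    ω   : IT
    _⊓_ : IT → IT → IT
    ⌜_⌝ : Ty → IT

-- The constructors ⊓-comm …
-- ω-unitʳ (both directions) make ⊑ contain the ACI+ω-unit equivalence,
-- i.e. ⊑ is the paper's relation on the quotient, lifted to raw syntax.
infix 4 _⊑_
data _⊑_ : IT → IT → Set where
  ⊑-refl    : ∀ {U} → U ⊑ U
  ⊑-trans   : ∀ {U V W} → U ⊑ V → V ⊑ W → U ⊑ W
  ⊑-projˡ   : ∀ {U₁ U₂} → U₁ ⊓ U₂ ⊑ U₁
  ⊑-⊓       : ∀ {U₁ U₂ V₁ V₂} → U₁ ⊑ V₁ → U₂ ⊑ V₂ → U₁ ⊓ U₂ ⊑ V₁ ⊓ V₂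
  ⊑-⇒       : ∀ {U₁ U₂ T₁ T₂} → U₂ ⊑ U₁ → ⌜ T₁ ⌝ ⊑ ⌜ T₂ ⌝ → ⌜ U₁ ⇒ T₁ ⌝ ⊑ ⌜ U₂ ⇒ T₂ ⌝
  ⊓-comm    : ∀ {U V} → U ⊓ V ⊑ V ⊓ U
  ⊓-assoc   : ∀ {U V W} → (U ⊓ V) ⊓ W ⊑ U ⊓ (V ⊓ W)
  ⊓-assoc⁻  : ∀ {U V W} → U ⊓ (V ⊓ W) ⊑ (U ⊓ V) ⊓ W
  ⊓-idem    : ∀ {U} → U ⊓ U ⊑ U
  ⊓-idem⁻   : ∀ {U} → U ⊑ U ⊓ U
  ω-unit    : ∀ {U} → ω ⊓ U ⊑ U
  ω-unit⁻   : ∀ {U} → U ⊑ ω ⊓ U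

Env : Set
Env = ℕ → Maybe IT

Finite : Env → Set
Finite Γ = ∃ λ n → ∀ i → n ≤ i → Γ i ≡ nothing

-- Γ , x ∶ U   (used with the side condition Γ x ≡ nothing)
_,_∶_ : Env → ℕ → IT → Env
(Γ , x ∶ U) i = if i ≡ᵇ x then just U else Γ i

-- environment of the body of a λ: bound variable (index 0) gets m
cons : Maybe IT → Env → Env
cons m Γ zero    = m
cons m Γ (suc i) = Γ i

single : ℕ → Ty → Env
single x T i = if i ≡ᵇ x then just ⌜ T ⌝ else nothing

envω : Tm → Env
envω M i = if fv M i then just ω else nothing

_⊓ₑ_ : Env → Env → Env
(Γ₁ ⊓ₑ Γ₂) i with Γ₁ i | Γ₂ i
... | just U  | just U' = just (U ⊓ U')
... | just U  | nothing = just U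
... | nothing | just U' = just U'
... | nothing | nothing = nothing

-- subtyping on environments: same domain, pointwise ⊑
_⊑ₑ_ : Env → Env → Set
Γ ⊑ₑ Γ' = ∀ i → Pointwise _⊑_ (Γ i) (Γ' i)

record Typing : Set where
  constructor ⟨_⊢_⟩
  field
    env : Env
    ty  : IT

data _⊑ₜ_ : Typing → Typing → Set where
  ⊑ₜ-i : ∀ {Γ₁ Γ₂ U₁ U₂} → U₁ ⊑ U₂ → Γ₂ ⊑ₑ Γ₁ → ⟨ Γ₁ ⊢ U₁ ⟩ ⊑ₜ ⟨ Γ₂ ⊢ U₂ ⟩

infix 3 _⦂_
data _⦂_ : Tm → Typing → Set where
  ax   : ∀ x T → var x ⦂ ⟨ single x T ⊢ ⌜ T ⌝ ⟩
  ω-i  : ∀ M → M ⦂ ⟨ envω M ⊢ ω ⟩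
  ⇒-i  : ∀ {M Γ U T} → M ⦂ ⟨ cons (just U) Γ ⊢ ⌜ T ⌝ ⟩ → lam M ⦂ ⟨ Γ ⊢ ⌜ U ⇒ T ⌝ ⟩
  ⇒-i' : ∀ {M Γ T} → M ⦂ ⟨ cons nothing Γ ⊢ ⌜ T ⌝ ⟩ → lam M ⦂ ⟨ Γ ⊢ ⌜ ω ⇒ T ⌝ ⟩
  ⇒-e  : ∀ {M₁ M₂ Γ₁ Γ₂ U T} → M₁ ⦂ ⟨ Γ₁ ⊢ ⌜ U ⇒ T ⌝ ⟩ → M₂ ⦂ ⟨ Γ₂ ⊢ U ⟩
         → app M₁ M₂ ⦂ ⟨ Γ₁ ⊓ₑ Γ₂ ⊢ ⌜ T ⌝ ⟩
  ⊓-i  : ∀ {M Γ U₁ U₂} → M ⦂ ⟨ Γ ⊢ U₁ ⟩ → M ⦂ ⟨ Γ ⊢ U₂ ⟩ → M ⦂ ⟨ Γ ⊢ U₁ ⊓ U₂ ⟩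
  ⊑-r  : ∀ {M Φ Φ'} → M ⦂ Φ → Φ ⊑ₜ Φ' → M ⦂ Φ'

-- The proof is by induction on the derivation of M, generalised to an
-- arbitrary environment Γ₀ with Γ₀ x = just U; the result environment is
-- (Γ₀ ∖ x) ⊓ Δ, where Γ₀ ∖ x deletes the declaration of x.  Since ⇒-e splits the environment of M, the
-- variable x may end up in only one of the two premises; the other premise
-- is then untouched by the substitution because, in this system, the domain
-- of every typing environment is exactly the set of free variables of the
-- term (lemma `domain`).  The ω-rule case needs the same fact together with
-- a computation of FV(M[x:=N]).  Going under a binder shifts N, so we also
-- prove that typings are stable under injective renamings.
module Submission where

open import Defs
open import Data.Nat using (ℕ; zero; suc; _≡ᵇ_)
open import Data.Nat.Properties using (≡ᵇ⇒≡; ≡⇒≡ᵇ)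
open import Data.Bool using (Bool; true; false; if_then_else_; _∨_; _∧_; not)
open import Data.Bool.Properties
  using (∨-commutativeMonoid; ∧-distribʳ-∨; ∧-inverseʳ; ∧-zeroʳ; ∧-identityʳ; ∨-conicalˡ; ∨-conicalʳ)
open import Data.Maybe using (Maybe; just; nothing; is-just; maybe′; _>>=_)
import Data.Maybe as Maybe
open import Data.Maybe.Properties using (just-injective)
open import Data.Maybe.Relation.Binary.Pointwise using (Pointwise; just; nothing; just-inv)
import Data.Maybe.Relation.Binary.Pointwise as Pointwise
open import Data.Product using (_,_)
open import Function using (_∘_)
open import Algebra.Bundles using (CommutativeMonoid)
open import Algebra.Properties.CommutativeSemigroup
  (CommutativeMonoid.commutativeSemigroup ∨-commutativeMonoid) using (interchange)
open import Relation.Nullary.Reflects using (Reflects; ofʸ; ofⁿ; fromEquivalence; det)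
open import Relation.Binary.Bundles using (Preorder)
open import Relation.Binary.PropositionalEquality

≡ᵇ-reflects : ∀ m n → Reflects (m ≡ n) (m ≡ᵇ n)
≡ᵇ-reflects m n = fromEquivalence (≡ᵇ⇒≡ m n) (≡⇒≡ᵇ m n)

≡ᵇ-cong : ∀ {m n m' n'} → (m ≡ n → m' ≡ n') → (m' ≡ n' → m ≡ n) → (m ≡ᵇ n) ≡ (m' ≡ᵇ n')
≡ᵇ-cong {m} {n} {m'} {n'} to from =
  det (≡ᵇ-reflects m n) (fromEquivalence (from ∘ ≡ᵇ⇒≡ m' n') (≡⇒≡ᵇ m' n' ∘ to))

≡ᵇ-refl : ∀ n → (n ≡ᵇ n) ≡ true
≡ᵇ-refl n = det (≡ᵇ-reflects n n) (ofʸ refl)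

≡ᵇ-sym : ∀ m n → (m ≡ᵇ n) ≡ (n ≡ᵇ m)
≡ᵇ-sym m n = ≡ᵇ-cong {m} {n} sym sym

≡ᵇ-false : ∀ {m n} → m ≢ n → (m ≡ᵇ n) ≡ false
≡ᵇ-false {m} {n} m≢n = det (≡ᵇ-reflects m n) (ofⁿ m≢n)

⊑-projʳ : ∀ {U V} → U ⊓ V ⊑ V
⊑-projʳ = ⊑-trans ⊓-comm ⊑-projˡ

⊑-ω : ∀ {U} → U ⊑ ω
⊑-ω = ⊑-trans ω-unit⁻ ⊑-projˡ

infixl 6 _⊓ᵐ_
_⊓ᵐ_ : Maybe IT → Maybe IT → Maybe IT
just U ⊓ᵐ just V  = just (U ⊓ V)
just U ⊓ᵐ nothing = just U
nothing ⊓ᵐ m      = m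

infix 4 _⊑ᵐ_
_⊑ᵐ_ : Maybe IT → Maybe IT → Set
_⊑ᵐ_ = Pointwise _⊑_

⊑ᵐ-refl : ∀ {m} → m ⊑ᵐ m
⊑ᵐ-refl = Pointwise.refl ⊑-refl

⊑ᵐ-trans : ∀ {m₁ m₂ m₃} → m₁ ⊑ᵐ m₂ → m₂ ⊑ᵐ m₃ → m₁ ⊑ᵐ m₃
⊑ᵐ-trans = Pointwise.trans ⊑-trans

⊑ᵐ-preorder : Preorder _ _ _
⊑ᵐ-preorder = record
  { Carrier    = Maybe IT
  ; _≈_        = _≡_
  ; _≲_        = _⊑ᵐ_
  ; isPreorder = record
    { isEquivalence = isEquivalence
    ; reflexive     = λ { refl → ⊑ᵐ-refl }
    ; trans         = ⊑ᵐ-trans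
    }
  }

⊑ᵐ-is-just : ∀ {m m'} → m ⊑ᵐ m' → is-just m ≡ is-just m'
⊑ᵐ-is-just (just _) = refl
⊑ᵐ-is-just nothing  = refl

is-just-⊓ᵐ : ∀ m m' → is-just (m ⊓ᵐ m') ≡ is-just m ∨ is-just m'
is-just-⊓ᵐ (just U) (just V) = refl
is-just-⊓ᵐ (just U) nothing  = refl
is-just-⊓ᵐ nothing  m'       = refl

⊓ᵐ-mono : ∀ {m₁ m₁' m₂ m₂'} → m₁ ⊑ᵐ m₁' → m₂ ⊑ᵐ m₂' → m₁ ⊓ᵐ m₂ ⊑ᵐ m₁' ⊓ᵐ m₂'
⊓ᵐ-mono (just p) (just q) = just (⊑-⊓ p q)
⊓ᵐ-mono (just p) nothing  = just p
⊓ᵐ-mono nothing  q        = q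

⊓ᵐ-monoˡ : ∀ {m₁ m₁'} → m₁ ⊑ᵐ m₁' → ∀ m₂ → m₁ ⊓ᵐ m₂ ⊑ᵐ m₁' ⊓ᵐ m₂
⊓ᵐ-monoˡ p m₂ = ⊓ᵐ-mono p (⊑ᵐ-refl {m₂})

⊓ᵐ-monoʳ : ∀ m₁ {m₂ m₂'} → m₂ ⊑ᵐ m₂' → m₁ ⊓ᵐ m₂ ⊑ᵐ m₁ ⊓ᵐ m₂'
⊓ᵐ-monoʳ m₁ q = ⊓ᵐ-mono (⊑ᵐ-refl {m₁}) q

⊓ᵐ-assoc : ∀ m₁ m₂ m₃ → (m₁ ⊓ᵐ m₂) ⊓ᵐ m₃ ⊑ᵐ m₁ ⊓ᵐ (m₂ ⊓ᵐ m₃)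
⊓ᵐ-assoc (just U₁) (just U₂) (just U₃) = just ⊓-assoc
⊓ᵐ-assoc (just U₁) (just U₂) nothing   = ⊑ᵐ-refl
⊓ᵐ-assoc (just U₁) nothing   m₃        = ⊑ᵐ-refl
⊓ᵐ-assoc nothing   m₂        m₃        = ⊑ᵐ-refl

⊓ᵐ-assoc⁻ : ∀ m₁ m₂ m₃ → m₁ ⊓ᵐ (m₂ ⊓ᵐ m₃) ⊑ᵐ (m₁ ⊓ᵐ m₂) ⊓ᵐ m₃
⊓ᵐ-assoc⁻ (just U₁) (just U₂) (just U₃) = just ⊓-assoc⁻
⊓ᵐ-assoc⁻ (just U₁) (just U₂) nothing   = ⊑ᵐ-refl
⊓ᵐ-assoc⁻ (just U₁) nothing   m₃        = ⊑ᵐ-refl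
⊓ᵐ-assoc⁻ nothing   m₂        m₃        = ⊑ᵐ-refl

⊓ᵐ-comm : ∀ m₁ m₂ → m₁ ⊓ᵐ m₂ ⊑ᵐ m₂ ⊓ᵐ m₁
⊓ᵐ-comm (just U₁) (just U₂) = just ⊓-comm
⊓ᵐ-comm (just U₁) nothing   = ⊑ᵐ-refl
⊓ᵐ-comm nothing   (just U₂) = ⊑ᵐ-refl
⊓ᵐ-comm nothing   nothing   = ⊑ᵐ-refl

⊓ᵐ-idem⁻ : ∀ m → m ⊑ᵐ m ⊓ᵐ m
⊓ᵐ-idem⁻ (just U) = just ⊓-idem⁻
⊓ᵐ-idem⁻ nothing  = nothing

module _ where
  open import Relation.Binary.Reasoning.Preorder ⊑ᵐ-preorder

  ⊓ᵐ-interchange : ∀ m₁ m₂ m₃ m₄ → (m₁ ⊓ᵐ m₂) ⊓ᵐ (m₃ ⊓ᵐ m₄) ⊑ᵐ (m₁ ⊓ᵐ m₃) ⊓ᵐ (m₂ ⊓ᵐ m₄)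
  ⊓ᵐ-interchange m₁ m₂ m₃ m₄ = begin
    (m₁ ⊓ᵐ m₂) ⊓ᵐ (m₃ ⊓ᵐ m₄)  ≲⟨ ⊓ᵐ-assoc m₁ m₂ (m₃ ⊓ᵐ m₄) ⟩
    m₁ ⊓ᵐ (m₂ ⊓ᵐ (m₃ ⊓ᵐ m₄))  ≲⟨ ⊓ᵐ-monoʳ m₁ (⊓ᵐ-assoc⁻ m₂ m₃ m₄) ⟩
    m₁ ⊓ᵐ ((m₂ ⊓ᵐ m₃) ⊓ᵐ m₄)  ≲⟨ ⊓ᵐ-monoʳ m₁ (⊓ᵐ-monoˡ (⊓ᵐ-comm m₂ m₃) m₄) ⟩
    m₁ ⊓ᵐ ((m₃ ⊓ᵐ m₂) ⊓ᵐ m₄)  ≲⟨ ⊓ᵐ-monoʳ m₁ (⊓ᵐ-assoc m₃ m₂ m₄) ⟩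
    m₁ ⊓ᵐ (m₃ ⊓ᵐ (m₂ ⊓ᵐ m₄))  ≲⟨ ⊓ᵐ-assoc⁻ m₁ m₃ (m₂ ⊓ᵐ m₄) ⟩
    (m₁ ⊓ᵐ m₃) ⊓ᵐ (m₂ ⊓ᵐ m₄)  ∎

  ⊓ᵐ-distrib : ∀ m₁ m₂ m₃ → (m₁ ⊓ᵐ m₂) ⊓ᵐ m₃ ⊑ᵐ (m₁ ⊓ᵐ m₃) ⊓ᵐ (m₂ ⊓ᵐ m₃)
  ⊓ᵐ-distrib m₁ m₂ m₃ = begin
    (m₁ ⊓ᵐ m₂) ⊓ᵐ m₃          ≲⟨ ⊓ᵐ-monoʳ (m₁ ⊓ᵐ m₂) (⊓ᵐ-idem⁻ m₃) ⟩
    (m₁ ⊓ᵐ m₂) ⊓ᵐ (m₃ ⊓ᵐ m₃)  ≲⟨ ⊓ᵐ-interchange m₁ m₂ m₃ m₃ ⟩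
    (m₁ ⊓ᵐ m₃) ⊓ᵐ (m₂ ⊓ᵐ m₃)  ∎

  ⊓ᵐ-swapʳ : ∀ m₁ m₂ m₃ → (m₁ ⊓ᵐ m₂) ⊓ᵐ m₃ ⊑ᵐ (m₁ ⊓ᵐ m₃) ⊓ᵐ m₂
  ⊓ᵐ-swapʳ m₁ m₂ m₃ = begin
    (m₁ ⊓ᵐ m₂) ⊓ᵐ m₃  ≲⟨ ⊓ᵐ-assoc m₁ m₂ m₃ ⟩
    m₁ ⊓ᵐ (m₂ ⊓ᵐ m₃)  ≲⟨ ⊓ᵐ-monoʳ m₁ (⊓ᵐ-comm m₂ m₃) ⟩
    m₁ ⊓ᵐ (m₃ ⊓ᵐ m₂)  ≲⟨ ⊓ᵐ-assoc⁻ m₁ m₃ m₂ ⟩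
    (m₁ ⊓ᵐ m₃) ⊓ᵐ m₂  ∎

open ≡-Reasoning

⊓ₑ-pointwise : ∀ Γ₁ Γ₂ i → (Γ₁ ⊓ₑ Γ₂) i ≡ Γ₁ i ⊓ᵐ Γ₂ i
⊓ₑ-pointwise Γ₁ Γ₂ i with Γ₁ i | Γ₂ i
... | just U  | just V  = refl
... | just U  | nothing = refl
... | nothing | just V  = refl
... | nothing | nothing = refl

infixl 25 _∖_
_∖_ : Env → ℕ → Env
(Γ ∖ x) i = if i ≡ᵇ x then nothing else Γ i

∖-undeclared : ∀ {Γ x} → Γ x ≡ nothing → Γ ∖ x ≗ Γ
∖-undeclared {Γ} {x} Γx i with i ≡ᵇ x | ≡ᵇ-reflects i x
... | _ | ofʸ refl = sym Γx
... | _ | ofⁿ _    = refl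

∖-extend : ∀ {Γ x U} → Γ x ≡ nothing → (Γ , x ∶ U) ∖ x ≗ Γ
∖-extend {Γ} {x} Γx i with i ≡ᵇ x | ≡ᵇ-reflects i x
... | _ | ofʸ refl = sym Γx
... | _ | ofⁿ _    = refl

∖-⊓ₑ : ∀ Γ₁ Γ₂ x i → ((Γ₁ ⊓ₑ Γ₂) ∖ x) i ≡ (Γ₁ ∖ x) i ⊓ᵐ (Γ₂ ∖ x) i
∖-⊓ₑ Γ₁ Γ₂ x i with i ≡ᵇ x
... | true  = refl
... | false = ⊓ₑ-pointwise Γ₁ Γ₂ i

is-just-∖⊓ₑ : ∀ Γ x Δ i → is-just ((Γ ∖ x ⊓ₑ Δ) i) ≡ (is-just (Γ i) ∧ not (i ≡ᵇ x)) ∨ is-just (Δ i)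
is-just-∖⊓ₑ Γ x Δ i = begin
  is-just ((Γ ∖ x ⊓ₑ Δ) i)                     ≡⟨ cong is-just (⊓ₑ-pointwise (Γ ∖ x) Δ i) ⟩
  is-just ((Γ ∖ x) i ⊓ᵐ Δ i)                   ≡⟨ is-just-⊓ᵐ ((Γ ∖ x) i) (Δ i) ⟩
  is-just ((Γ ∖ x) i) ∨ is-just (Δ i)          ≡⟨ cong (_∨ is-just (Δ i)) is-just-∖ ⟩
  (is-just (Γ i) ∧ not (i ≡ᵇ x)) ∨ is-just (Δ i) ∎
  where
  is-just-∖ : is-just ((Γ ∖ x) i) ≡ is-just (Γ i) ∧ not (i ≡ᵇ x)
  is-just-∖ with i ≡ᵇ x
  ... | true  = sym (∧-zeroʳ (is-just (Γ i)))
  ... | false = sym (∧-identityʳ (is-just (Γ i)))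

⦂-env : ∀ {M Γ Γ' U} → Γ' ⊑ₑ Γ → M ⦂ ⟨ Γ ⊢ U ⟩ → M ⦂ ⟨ Γ' ⊢ U ⟩
⦂-env Γ'⊑Γ d = ⊑-r d (⊑ₜ-i ⊑-refl Γ'⊑Γ)

⦂-env-≗ : ∀ {M Γ Γ' U} → Γ' ≗ Γ → M ⦂ ⟨ Γ ⊢ U ⟩ → M ⦂ ⟨ Γ' ⊢ U ⟩
⦂-env-≗ Γ'≗Γ = ⦂-env (λ i → Pointwise.reflexive (λ { refl → ⊑-refl }) (Γ'≗Γ i))

⦂-ty : ∀ {M Γ U U'} → U ⊑ U' → M ⦂ ⟨ Γ ⊢ U ⟩ → M ⦂ ⟨ Γ ⊢ U' ⟩
⦂-ty U⊑U' d = ⊑-r d (⊑ₜ-i U⊑U' (λ i → ⊑ᵐ-refl))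

-- How the environment of a substitution instance of an application
-- compares with the environments of the two substituted premises,
-- according to which premises declare x.

∖⊓ₑ-split : ∀ Γ₁ Γ₂ x Δ i → ((Γ₁ ⊓ₑ Γ₂) ∖ x ⊓ₑ Δ) i ≡ ((Γ₁ ∖ x) i ⊓ᵐ (Γ₂ ∖ x) i) ⊓ᵐ Δ i
∖⊓ₑ-split Γ₁ Γ₂ x Δ i = trans (⊓ₑ-pointwise ((Γ₁ ⊓ₑ Γ₂) ∖ x) Δ i) (cong (_⊓ᵐ Δ i) (∖-⊓ₑ Γ₁ Γ₂ x i))

∖⊓ₑ-both : ∀ Γ₁ Γ₂ x Δ → ((Γ₁ ⊓ₑ Γ₂) ∖ x ⊓ₑ Δ) ⊑ₑ ((Γ₁ ∖ x ⊓ₑ Δ) ⊓ₑ (Γ₂ ∖ x ⊓ₑ Δ))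
∖⊓ₑ-both Γ₁ Γ₂ x Δ i
  rewrite ∖⊓ₑ-split Γ₁ Γ₂ x Δ i | ⊓ₑ-pointwise (Γ₁ ∖ x ⊓ₑ Δ) (Γ₂ ∖ x ⊓ₑ Δ) i
        | ⊓ₑ-pointwise (Γ₁ ∖ x) Δ i | ⊓ₑ-pointwise (Γ₂ ∖ x) Δ i
  = ⊓ᵐ-distrib ((Γ₁ ∖ x) i) ((Γ₂ ∖ x) i) (Δ i)

∖⊓ₑ-left : ∀ Γ₁ Γ₂ x Δ → Γ₂ x ≡ nothing → ((Γ₁ ⊓ₑ Γ₂) ∖ x ⊓ₑ Δ) ⊑ₑ ((Γ₁ ∖ x ⊓ₑ Δ) ⊓ₑ Γ₂)
∖⊓ₑ-left Γ₁ Γ₂ x Δ Γ₂x i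
  rewrite ∖⊓ₑ-split Γ₁ Γ₂ x Δ i | ∖-undeclared {Γ₂} Γ₂x i
        | ⊓ₑ-pointwise (Γ₁ ∖ x ⊓ₑ Δ) Γ₂ i | ⊓ₑ-pointwise (Γ₁ ∖ x) Δ i
  = ⊓ᵐ-swapʳ ((Γ₁ ∖ x) i) (Γ₂ i) (Δ i)

∖⊓ₑ-right : ∀ Γ₁ Γ₂ x Δ → Γ₁ x ≡ nothing → ((Γ₁ ⊓ₑ Γ₂) ∖ x ⊓ₑ Δ) ⊑ₑ (Γ₁ ⊓ₑ (Γ₂ ∖ x ⊓ₑ Δ))
∖⊓ₑ-right Γ₁ Γ₂ x Δ Γ₁x i
  rewrite ∖⊓ₑ-split Γ₁ Γ₂ x Δ i | ∖-undeclared {Γ₁} Γ₁x i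
        | ⊓ₑ-pointwise Γ₁ (Γ₂ ∖ x ⊓ₑ Δ) i | ⊓ₑ-pointwise (Γ₂ ∖ x) Δ i
  = ⊓ᵐ-assoc (Γ₁ i) ((Γ₂ ∖ x) i) (Δ i)

∖⊓ₑ-mono : ∀ {Γ Γ'} x Δ → Γ' ⊑ₑ Γ → (Γ' ∖ x ⊓ₑ Δ) ⊑ₑ (Γ ∖ x ⊓ₑ Δ)
∖⊓ₑ-mono {Γ} {Γ'} x Δ Γ'⊑Γ i
  rewrite ⊓ₑ-pointwise (Γ' ∖ x) Δ i | ⊓ₑ-pointwise (Γ ∖ x) Δ i
  = ⊓ᵐ-monoˡ ∖-mono (Δ i)
  where
  ∖-mono : (Γ' ∖ x) i ⊑ᵐ (Γ ∖ x) i
  ∖-mono with i ≡ᵇ x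
  ... | true  = nothing
  ... | false = Γ'⊑Γ i

is-just-if : ∀ b (U : IT) → is-just (if b then just U else nothing) ≡ b
is-just-if true  U = refl
is-just-if false U = refl

domain : ∀ {M Γ U} → M ⦂ ⟨ Γ ⊢ U ⟩ → ∀ i → is-just (Γ i) ≡ fv M i
domain (ax x T)   i = trans (is-just-if (i ≡ᵇ x) ⌜ T ⌝) (≡ᵇ-sym i x)
domain (ω-i M)    i = is-just-if (fv M i) ω
domain (⇒-i d)    i = domain d (suc i)
domain (⇒-i' d)   i = domain d (suc i)
domain (⇒-e {M₁} {M₂} {Γ₁} {Γ₂} d₁ d₂) i = begin
  is-just ((Γ₁ ⊓ₑ Γ₂) i)           ≡⟨ cong is-just (⊓ₑ-pointwise Γ₁ Γ₂ i) ⟩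
  is-just (Γ₁ i ⊓ᵐ Γ₂ i)           ≡⟨ is-just-⊓ᵐ (Γ₁ i) (Γ₂ i) ⟩
  is-just (Γ₁ i) ∨ is-just (Γ₂ i)  ≡⟨ cong₂ _∨_ (domain d₁ i) (domain d₂ i) ⟩
  fv M₁ i ∨ fv M₂ i                ∎
domain (⊓-i d _)  i = domain d i
domain (⊑-r d (⊑ₜ-i _ Γ'⊑Γ)) i = trans (⊑ᵐ-is-just (Γ'⊑Γ i)) (domain d i)

ω-by-domain : ∀ {M Γ} → (∀ i → is-just (Γ i) ≡ fv M i) → M ⦂ ⟨ Γ ⊢ ω ⟩
ω-by-domain {M} {Γ} dom = ⦂-env (λ i → below-envω (Γ i) (fv M i) (dom i)) (ω-i M)
  where
  below-envω : ∀ m b → is-just m ≡ b → m ⊑ᵐ (if b then just ω else nothing)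
  below-envω (just U) .true  refl = just ⊑-ω
  below-envω nothing  .false refl = nothing

undeclared-not-free : ∀ {M Γ U x} → M ⦂ ⟨ Γ ⊢ U ⟩ → Γ x ≡ nothing → fv M x ≡ false
undeclared-not-free {x = x} d Γx = trans (sym (domain d x)) (cong is-just Γx)

record PartialInverse (ρ : ℕ → ℕ) (π : ℕ → Maybe ℕ) : Set where
  field
    inverse-of : ∀ i → π (ρ i) ≡ just i
    preimage   : ∀ {j i} → π j ≡ just i → ρ i ≡ j
open PartialInverse

extπ : (ℕ → Maybe ℕ) → ℕ → Maybe ℕ
extπ π zero    = just zero
extπ π (suc j) = Maybe.map suc (π j)

ext-inverse : ∀ {ρ π} → PartialInverse ρ π → PartialInverse (ext ρ) (extπ π)
inverse-of (ext-inverse P) zero    = refl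
inverse-of (ext-inverse P) (suc i) = cong (Maybe.map suc) (inverse-of P i)
preimage (ext-inverse P) {zero} refl = refl
preimage (ext-inverse {π = π} P) {suc j} eq with π j in πj
preimage (ext-inverse P) {suc j} refl | just k = cong suc (preimage P πj)

pullback : (ℕ → Maybe ℕ) → Env → Env
pullback π Γ j = π j >>= Γ

≡ᵇ-preimage : ∀ {ρ π} → PartialInverse ρ π → ∀ x j → (j ≡ᵇ ρ x) ≡ maybe′ (_≡ᵇ x) false (π j)
≡ᵇ-preimage {ρ} {π} P x j with π j in πj
... | just i  = ≡ᵇ-cong {j} {ρ x} (λ j≡ρx → just-injective (π-at j≡ρx))
                        (λ i≡x → trans (sym (preimage P πj)) (cong ρ i≡x))
  where
  π-at : j ≡ ρ x → just i ≡ just x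
  π-at j≡ρx = trans (sym πj) (trans (cong π j≡ρx) (inverse-of P x))
... | nothing = ≡ᵇ-false λ j≡ρx → nothing≢just (trans (sym πj) (trans (cong π j≡ρx) (inverse-of P x)))
  where
  nothing≢just : nothing ≢ just x
  nothing≢just ()

fv-ren : ∀ {ρ π} → PartialInverse ρ π → ∀ M j → fv (ren ρ M) j ≡ maybe′ (fv M) false (π j)
fv-ren {ρ} {π} P (var k) j = begin
  ρ k ≡ᵇ j                    ≡⟨ ≡ᵇ-sym (ρ k) j ⟩
  j ≡ᵇ ρ k                    ≡⟨ ≡ᵇ-preimage P k j ⟩
  maybe′ (_≡ᵇ k) false (π j)  ≡⟨ flip (π j) ⟩
  maybe′ (k ≡ᵇ_) false (π j)  ∎
  where
  flip : ∀ m → maybe′ (_≡ᵇ k) false m ≡ maybe′ (k ≡ᵇ_) false m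
  flip (just i) = ≡ᵇ-sym i k
  flip nothing  = refl
fv-ren {π = π} P (lam M) j with π j | fv-ren (ext-inverse P) M (suc j)
... | just i  | eq = eq
... | nothing | eq = eq
fv-ren {π = π} P (app M N) j with π j | fv-ren P M j | fv-ren P N j
... | just i  | eqM | eqN = cong₂ _∨_ eqM eqN
... | nothing | eqM | eqN = cong₂ _∨_ eqM eqN

pullback-single : ∀ {ρ π} → PartialInverse ρ π → ∀ x T → pullback π (single x T) ≗ single (ρ x) T
pullback-single {ρ} {π} P x T j rewrite ≡ᵇ-preimage P x j with π j
... | just i  = refl
... | nothing = refl

pullback-envω : ∀ {ρ π} → PartialInverse ρ π → ∀ M → pullback π (envω M) ≗ envω (ren ρ M)
pullback-envω {π = π} P M j rewrite fv-ren P M j with π j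
... | just i  = refl
... | nothing = refl

pullback-cons : ∀ π m Γ → cons m (pullback π Γ) ≗ pullback (extπ π) (cons m Γ)
pullback-cons π m Γ zero    = refl
pullback-cons π m Γ (suc j) with π j
... | just i  = refl
... | nothing = refl

pullback-⊓ₑ : ∀ π Γ₁ Γ₂ → pullback π (Γ₁ ⊓ₑ Γ₂) ≗ (pullback π Γ₁ ⊓ₑ pullback π Γ₂)
pullback-⊓ₑ π Γ₁ Γ₂ j rewrite ⊓ₑ-pointwise (pullback π Γ₁) (pullback π Γ₂) j with π j
... | just i  = ⊓ₑ-pointwise Γ₁ Γ₂ i
... | nothing = refl

pullback-mono : ∀ π {Γ Γ'} → Γ' ⊑ₑ Γ → pullback π Γ' ⊑ₑ pullback π Γ
pullback-mono π Γ'⊑Γ j with π j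
... | just i  = Γ'⊑Γ i
... | nothing = nothing

ren-ty : ∀ {ρ π} → PartialInverse ρ π → ∀ {M Γ U} → M ⦂ ⟨ Γ ⊢ U ⟩ → ren ρ M ⦂ ⟨ pullback π Γ ⊢ U ⟩
ren-ty {ρ} P (ax x T) = ⦂-env-≗ (pullback-single P x T) (ax (ρ x) T)
ren-ty {ρ} P (ω-i M)  = ⦂-env-≗ (pullback-envω P M) (ω-i (ren ρ M))
ren-ty {π = π} P (⇒-i {Γ = Γ} {U} d) =
  ⇒-i (⦂-env-≗ (pullback-cons π (just U) Γ) (ren-ty (ext-inverse P) d))
ren-ty {π = π} P (⇒-i' {Γ = Γ} d) =
  ⇒-i' (⦂-env-≗ (pullback-cons π nothing Γ) (ren-ty (ext-inverse P) d))
ren-ty {π = π} P (⇒-e {Γ₁ = Γ₁} {Γ₂} d₁ d₂) =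
  ⦂-env-≗ (pullback-⊓ₑ π Γ₁ Γ₂) (⇒-e (ren-ty P d₁) (ren-ty P d₂))
ren-ty P (⊓-i d₁ d₂) = ⊓-i (ren-ty P d₁) (ren-ty P d₂)
ren-ty {π = π} P (⊑-r d (⊑ₜ-i U⊑U' Γ'⊑Γ)) = ⊑-r (ren-ty P d) (⊑ₜ-i U⊑U' (pullback-mono π Γ'⊑Γ))

unshift : ℕ → Maybe ℕ
unshift zero    = nothing
unshift (suc j) = just j

shift-inverse : PartialInverse suc unshift
inverse-of shift-inverse i = refl
preimage shift-inverse {suc j} refl = refl

fv-shift : ∀ N i → fv (ren suc N) (suc i) ≡ fv N i
fv-shift N i = fv-ren shift-inverse N (suc i)

shift-ty : ∀ {N Δ U} → N ⦂ ⟨ Δ ⊢ U ⟩ → ren suc N ⦂ ⟨ cons nothing Δ ⊢ U ⟩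
shift-ty {Δ = Δ} d = ⦂-env-≗ cons≗pullback (ren-ty shift-inverse d)
  where
  cons≗pullback : cons nothing Δ ≗ pullback unshift Δ
  cons≗pullback zero    = refl
  cons≗pullback (suc j) = refl

_≔_ : ℕ → Tm → ℕ → Tm
(x ≔ N) i = if i ≡ᵇ x then N else var i

exts-cong : ∀ {σ τ} → σ ≗ τ → exts σ ≗ exts τ
exts-cong σ≗τ zero    = refl
exts-cong σ≗τ (suc i) = cong (ren suc) (σ≗τ i)

sub-cong : ∀ {σ τ} → σ ≗ τ → ∀ M → sub σ M ≡ sub τ M
sub-cong σ≗τ (var i)   = σ≗τ i
sub-cong σ≗τ (lam M)   = cong lam (sub-cong (exts-cong σ≗τ) M)
sub-cong σ≗τ (app M N) = cong₂ app (sub-cong σ≗τ M) (sub-cong σ≗τ N)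

exts-≔ : ∀ x N → exts (x ≔ N) ≗ (suc x ≔ ren suc N)
exts-≔ x N zero    = refl
exts-≔ x N (suc i) with i ≡ᵇ x
... | true  = refl
... | false = refl

fv-sub : ∀ M x N i → fv (sub (x ≔ N) M) i ≡ (fv M i ∧ not (i ≡ᵇ x)) ∨ (fv M x ∧ fv N i)
fv-sub (var j) x N i with j ≡ᵇ x | ≡ᵇ-reflects j x
... | _ | ofʸ refl rewrite ≡ᵇ-sym j i | ∧-inverseʳ (i ≡ᵇ j) = refl
... | _ | ofⁿ j≢x with j ≡ᵇ i | ≡ᵇ-reflects j i
...   | _ | ofʸ refl rewrite ≡ᵇ-false j≢x = refl
...   | _ | ofⁿ _    = refl
fv-sub (lam M) x N i = begin
  fv (sub (exts (x ≔ N)) M) (suc i)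
    ≡⟨ cong (λ t → fv t (suc i)) (sub-cong (exts-≔ x N) M) ⟩
  fv (sub (suc x ≔ ren suc N) M) (suc i)
    ≡⟨ fv-sub M (suc x) (ren suc N) (suc i) ⟩
  (fv M (suc i) ∧ not (i ≡ᵇ x)) ∨ (fv M (suc x) ∧ fv (ren suc N) (suc i))
    ≡⟨ cong (λ b → (fv M (suc i) ∧ not (i ≡ᵇ x)) ∨ (fv M (suc x) ∧ b)) (fv-shift N i) ⟩
  (fv M (suc i) ∧ not (i ≡ᵇ x)) ∨ (fv M (suc x) ∧ fv N i)
    ∎
fv-sub (app M₁ M₂) x N i = begin
  fv (sub (x ≔ N) M₁) i ∨ fv (sub (x ≔ N) M₂) i
    ≡⟨ cong₂ _∨_ (fv-sub M₁ x N i) (fv-sub M₂ x N i) ⟩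
  ((a₁ ∧ c) ∨ (b₁ ∧ n)) ∨ ((a₂ ∧ c) ∨ (b₂ ∧ n))
    ≡⟨ interchange (a₁ ∧ c) (b₁ ∧ n) (a₂ ∧ c) (b₂ ∧ n) ⟩
  ((a₁ ∧ c) ∨ (a₂ ∧ c)) ∨ ((b₁ ∧ n) ∨ (b₂ ∧ n))
    ≡⟨ cong₂ _∨_ (∧-distribʳ-∨ c a₁ a₂) (∧-distribʳ-∨ n b₁ b₂) ⟨
  ((a₁ ∨ a₂) ∧ c) ∨ ((b₁ ∨ b₂) ∧ n)
    ∎
  where
  a₁ a₂ b₁ b₂ c n : Bool
  a₁ = fv M₁ i
  a₂ = fv M₂ i
  b₁ = fv M₁ x
  b₂ = fv M₂ x
  c  = not (i ≡ᵇ x)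
  n  = fv N i

sub-not-free : ∀ M x N → fv M x ≡ false → sub (x ≔ N) M ≡ M
sub-not-free (var j)     x N j≢x = cong (λ b → if b then N else var j) j≢x
sub-not-free (lam M)     x N x∉M =
  cong lam (trans (sub-cong (exts-≔ x N) M) (sub-not-free M (suc x) (ren suc N) x∉M))
sub-not-free (app M₁ M₂) x N x∉M =
  cong₂ app (sub-not-free M₁ x N (∨-conicalˡ _ _ x∉M)) (sub-not-free M₂ x N (∨-conicalʳ _ _ x∉M))

sub-undeclared : ∀ {M Γ V x} N → M ⦂ ⟨ Γ ⊢ V ⟩ → Γ x ≡ nothing → sub (x ≔ N) M ⦂ ⟨ Γ ⊢ V ⟩
sub-undeclared {M} {x = x} N d Γx =
  subst (_⦂ _) (sym (sub-not-free M x N (undeclared-not-free d Γx))) d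

single-∖⊓ₑ : ∀ x T Δ → (single x T ∖ x ⊓ₑ Δ) ≗ Δ
single-∖⊓ₑ x T Δ i rewrite ⊓ₑ-pointwise (single x T ∖ x) Δ i with i ≡ᵇ x
... | true  = refl
... | false = refl

ω-domain : ∀ M {x N Δ U} → fv M x ≡ true → N ⦂ ⟨ Δ ⊢ U ⟩
         → ∀ i → is-just ((envω M ∖ x ⊓ₑ Δ) i) ≡ fv (sub (x ≔ N) M) i
ω-domain M {x} {N} {Δ} x∈M dN i = begin
  is-just ((envω M ∖ x ⊓ₑ Δ) i)
    ≡⟨ is-just-∖⊓ₑ (envω M) x Δ i ⟩
  (is-just (envω M i) ∧ not (i ≡ᵇ x)) ∨ is-just (Δ i)
    ≡⟨ cong₂ (λ a b → (a ∧ not (i ≡ᵇ x)) ∨ b) (domain (ω-i M) i) (domain dN i) ⟩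
  (fv M i ∧ not (i ≡ᵇ x)) ∨ fv N i
    ≡⟨ cong (λ b → (fv M i ∧ not (i ≡ᵇ x)) ∨ (b ∧ fv N i)) x∈M ⟨
  (fv M i ∧ not (i ≡ᵇ x)) ∨ (fv M x ∧ fv N i)
    ≡⟨ fv-sub M x N i ⟨
  fv (sub (x ≔ N) M) i
    ∎

sub-under-binder : ∀ M {x N m Γ Δ V}
  → sub (suc x ≔ ren suc N) M ⦂ ⟨ cons m Γ ∖ suc x ⊓ₑ cons nothing Δ ⊢ V ⟩
  → sub (exts (x ≔ N)) M ⦂ ⟨ cons m (Γ ∖ x ⊓ₑ Δ) ⊢ V ⟩
sub-under-binder M {x} {N} {m} {Γ} {Δ} d =
  subst (_⦂ _) (sym (sub-cong (exts-≔ x N) M)) (⦂-env-≗ (cons-∖⊓ₑ m) d)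
  where
  cons-∖⊓ₑ : ∀ m → cons m (Γ ∖ x ⊓ₑ Δ) ≗ (cons m Γ ∖ suc x ⊓ₑ cons nothing Δ)
  cons-∖⊓ₑ (just U) zero    = refl
  cons-∖⊓ₑ nothing  zero    = refl
  cons-∖⊓ₑ m        (suc i) = refl

substitution : ∀ {M Γ V x U N Δ} → M ⦂ ⟨ Γ ⊢ V ⟩ → Γ x ≡ just U → N ⦂ ⟨ Δ ⊢ U ⟩
             → sub (x ≔ N) M ⦂ ⟨ Γ ∖ x ⊓ₑ Δ ⊢ V ⟩
substitution {x = x} {Δ = Δ} (ax y T) Γx dN with x ≡ᵇ y | ≡ᵇ-reflects x y
... | _ | ofʸ refl with refl ← Γx rewrite ≡ᵇ-refl x = ⦂-env-≗ (single-∖⊓ₑ x T Δ) dN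
... | _ | ofⁿ _ with () ← Γx
substitution {x = x} (ω-i M) Γx dN with fv M x in x∈M
... | true  with refl ← Γx = ω-by-domain (ω-domain M x∈M dN)
... | false with () ← Γx
substitution (⇒-i {M} d) Γx dN = ⇒-i (sub-under-binder M (substitution d Γx (shift-ty dN)))
substitution (⇒-i' {M} d) Γx dN = ⇒-i' (sub-under-binder M (substitution d Γx (shift-ty dN)))
substitution {x = x} {N = N} {Δ} (⇒-e {Γ₁ = Γ₁} {Γ₂} d₁ d₂) Γx dN
  with Γ₁ x in Γ₁x | Γ₂ x in Γ₂x | trans (sym (⊓ₑ-pointwise Γ₁ Γ₂ x)) Γx
... | just U₁ | just U₂ | refl =
  ⦂-env (∖⊓ₑ-both Γ₁ Γ₂ x Δ)
        (⇒-e (substitution d₁ Γ₁x (⦂-ty ⊑-projˡ dN)) (substitution d₂ Γ₂x (⦂-ty ⊑-projʳ dN)))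
... | just U₁ | nothing | refl =
  ⦂-env (∖⊓ₑ-left Γ₁ Γ₂ x Δ Γ₂x) (⇒-e (substitution d₁ Γ₁x dN) (sub-undeclared N d₂ Γ₂x))
... | nothing | just U₂ | refl =
  ⦂-env (∖⊓ₑ-right Γ₁ Γ₂ x Δ Γ₁x) (⇒-e (sub-undeclared N d₁ Γ₁x) (substitution d₂ Γ₂x dN))
... | nothing | nothing | ()
substitution (⊓-i d₁ d₂) Γx dN = ⊓-i (substitution d₁ Γx dN) (substitution d₂ Γx dN)
substitution {x = x} {Δ = Δ} (⊑-r {Φ = ⟨ Γ₁ ⊢ _ ⟩} d (⊑ₜ-i V⊑V' Γ⊑Γ₁)) Γx dN
  with just-inv (subst (_⊑ᵐ Γ₁ x) Γx (Γ⊑Γ₁ x))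
... | U₁ , Γ₁x , U⊑U₁ =
  ⊑-r (substitution d Γ₁x (⦂-ty U⊑U₁ dN)) (⊑ₜ-i V⊑V' (∖⊓ₑ-mono x Δ Γ⊑Γ₁))

lemma3p2 : (Γ Δ : Env) (x : ℕ) (U V : IT) (M N : Tm)
    → Finite Γ → Finite Δ → Γ x ≡ nothing
    → M ⦂ ⟨ (Γ , x ∶ U) ⊢ V ⟩ → N ⦂ ⟨ Δ ⊢ U ⟩
    → M [ x := N ] ⦂ ⟨ Γ ⊓ₑ Δ ⊢ V ⟩
lemma3p2 Γ Δ x U V M N _ _ Γx dM dN =
  ⦂-env-≗ env-eq (substitution dM x-declared dN)
  where
  x-declared : (Γ , x ∶ U) x ≡ just U
  x-declared rewrite ≡ᵇ-refl x = refl

  env-eq : (Γ ⊓ₑ Δ) ≗ ((Γ , x ∶ U) ∖ x ⊓ₑ Δ)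
  env-eq i = begin
    (Γ ⊓ₑ Δ) i                   ≡⟨ ⊓ₑ-pointwise Γ Δ i ⟩
    Γ i ⊓ᵐ Δ i                   ≡⟨ cong (_⊓ᵐ Δ i) (∖-extend {Γ} Γx i) ⟨
    ((Γ , x ∶ U) ∖ x) i ⊓ᵐ Δ i   ≡⟨ ⊓ₑ-pointwise ((Γ , x ∶ U) ∖ x) Δ i ⟨
    ((Γ , x ∶ U) ∖ x ⊓ₑ Δ) i     ∎
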